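{- If $A$ is a centrosymmetric $\{0,1,-1\}$-matrix, then $\mathrm{Geom}(A)$ is rc-invariant, and $\mathrm{Geom}(A)$ is generated by its even-size centrosymmetric elements; that is, every permutation in $\mathrm{Geom}(A)$ is contained in some centrosymmetric permutation of even size belonging to $\mathrm{Geom}(A)$.
   Context: A permutation of size $n$ is a bijection of $[n]$; $\pi$ contains $\sigma$ if some subsequence of $\pi$ has the same relative order as $\sigma$. For $\pi$ of size $n$, $\mathrm{rc}(\pi)(i)=n+1-\pi(n+1-i)$; $\pi$ is centrosymmetric if $\mathrm{rc}(\pi)=\pi$; a class $\mathcal{C}$ is rc-invariant if $\{\mathrm{rc}(\pi):\pi\in\mathcal{C}\}=\mathcal{C}$. Geometric grid classes: let $A$ be an $r\times c$ matrix with entries in $\{0,1,-1\}$ (row 1 at the top). Its standard figure is the subset of $[0,c]\times[0,r]$ obtained by placing in the unit square of cell $(i,j)$ (the square $[j-1,j]\times[r-i,r-i+1]$) the diagonal segment of slope $1$ if $A_{i,j}=1$, the diagonal segment of slope $-1$ if $A_{i,j}=-1$, and nothing if $A_{i,j}=0$. A set of $n$ points on the standard figure, no two sharing an $x$- or $y$-coordinate, determines the size-$n$ permutation whose diagram has the same relative order of points; $\mathrm{Geom}(A)$ is the set of all permutations so obtained. $A$ is centrosymmetric if $A_{i,j}=A_{r+1-i,\,c+1-j}$ for all $i,j$.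
   Formalization: The points on the standard figure that define $\mathrm{Geom}(A)$ have rational coordinates. -}

module Defs where

open import Data.Nat.Base using (ℕ; _*_)
open import Data.Fin.Base using (Fin; toℕ; opposite) renaming (_<_ to _<ᶠ_)
open import Data.Fin.Properties using (opposite-involutive)
open import Data.Fin.Permutation
  using (Permutation′; permutation; _⟨$⟩ʳ_; _⟨$⟩ˡ_; inverseˡ; inverseʳ)
open import Data.Integer.Base using (+_)
open import Data.Rational.Base using (ℚ; _/_; _+_; _-_; _≤_; _<_; 0ℚ; 1ℚ)
open import Data.Product using (Σ; ∃; ∃-syntax; _×_; _,_)
open import Data.Empty using (⊥)
open import Function.Bundles using (_⇔_)
open import Relation.Nullary using (¬_)
open import Relation.Binary.PropositionalEquality using (_≡_; cong; trans)

data Entry : Set where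
  e0  : Entry
  e+1 : Entry
  e-1 : Entry

-- r × c matrix; row index 0 is the top row (paper's row 1), column 0 the
-- leftmost column (paper's column 1).
Matrix : ℕ → ℕ → Set
Matrix r c = Fin r → Fin c → Entry

CentrosymmetricMatrix : ∀ {r c} → Matrix r c → Set
CentrosymmetricMatrix A = ∀ i j → A i j ≡ A (opposite i) (opposite j)

Perm : ℕ → Set
Perm = Permutation′

-- reverse-complement: rc(π)(i) = n+1-π(n+1-i); with 0-indexed Fin n this is
-- opposite (π (opposite i)).
rc : ∀ {n} → Perm n → Perm n
rc π = permutation (λ i → opposite (π ⟨$⟩ʳ opposite i))
                   (λ i → opposite (π ⟨$⟩ˡ opposite i))
                   (λ i → trans (cong opposite (trans (cong (π ⟨$⟩ʳ_) (opposite-involutive _)) (inverseʳ π)))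
                                (opposite-involutive i))
                   (λ i → trans (cong opposite (trans (cong (π ⟨$⟩ˡ_) (opposite-involutive _)) (inverseˡ π)))
                                (opposite-involutive i))

Centrosymmetric : ∀ {n} → Perm n → Set
Centrosymmetric π = ∀ i → rc π ⟨$⟩ʳ i ≡ π ⟨$⟩ʳ i

Contains : ∀ {n k} → Perm n → Perm k → Set
Contains {n} {k} π σ =
  Σ (Fin k → Fin n) λ f →
    (∀ a b → a <ᶠ b → f a <ᶠ f b) ×
    (∀ a b → (σ ⟨$⟩ʳ a <ᶠ σ ⟨$⟩ʳ b) ⇔ (π ⟨$⟩ʳ f a <ᶠ π ⟨$⟩ʳ f b))

ℕtoℚ : ℕ → ℚ
ℕtoℚ m = + m / 1

-- y-coordinate of a point at parameter t along the segment in cell (i,j).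
-- Cell (i,j) (0-indexed) is the unit square [j, j+1] × [r-1-i, r-i]
-- and r-1-i = toℕ (opposite i).
cellY : ∀ {r} → Entry → Fin r → ℚ → ℚ → Set
cellY e0  i t y = ⊥
cellY e+1 i t y = y ≡ ℕtoℚ (toℕ (opposite i)) + t
cellY e-1 i t y = y ≡ (ℕtoℚ (toℕ (opposite i)) + 1ℚ) - t

OnFigure : ∀ {r c} → Matrix r c → ℚ → ℚ → Set
OnFigure {r} {c} A x y =
  ∃[ i ] ∃[ j ] ∃[ t ] (0ℚ ≤ t × t ≤ 1ℚ ×
     x ≡ ℕtoℚ (toℕ j) + t × cellY (A i j) i t y)

-- Point a is the a-th from the left and has the (π a)-th smallest y.
InGeom : ∀ {r c} → Matrix r c → ∀ {n} → Perm n → Set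
InGeom A {n} π =
  Σ (Fin n → ℚ) λ x → Σ (Fin n → ℚ) λ y →
    (∀ a → OnFigure A (x a) (y a)) ×
    (∀ a b → ¬ a ≡ b → ¬ x a ≡ x b) ×
    (∀ a b → ¬ a ≡ b → ¬ y a ≡ y b) ×
    (∀ a b → (a <ᶠ b) ⇔ (x a < x b)) ×
    (∀ a b → (π ⟨$⟩ʳ a <ᶠ π ⟨$⟩ʳ b) ⇔ (y a < y b))

-- {rc(π) : π ∈ C} = C, for C given by a membership predicate on perms.
RcInvariant : (∀ {n} → Perm n → Set) → Set
RcInvariant C =
  (∀ {n} (π : Perm n) → C π → C (rc π)) ×
  (∀ {n} (π : Perm n) → C π → Σ (Perm n) λ τ → C τ × (∀ i → rc τ ⟨$⟩ʳ i ≡ π ⟨$⟩ʳ i))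

{-# OPTIONS --safe #-}
module Submission where

-- Reflection through the centre, (x , y) ↦ (c - x , r - y), maps the figure of a centrosymmetric
-- matrix onto itself, so it turns a point set realising π into one realising rc π.
--
-- For the second claim take points realising π, move each along its segment from parameter t to
-- (t + ½)/2 + δₐ, and add the reflections of the moved points (the reflection of the a-th point
-- moves by -δₐ). Shrinking towards the midpoint preserves the order of coordinates and leaves room
-- on the segment. If the δₐ are distinct, positive and below half of every positive coordinate gap
-- of the shrunk doubled configuration, strict order relations survive and every coincidence between
-- two of the 2n points is split, so their pattern σ is a permutation in Geom(A) containing π. It is
-- centrosymmetric because ranking a family symmetric under v ↦ K - v turns that symmetry into
-- k ↦ opposite k.

open import Defs
open import Data.Nat.Base using (ℕ; _*_)
open import Data.Product using (Σ; ∃-syntax; _×_)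

open import Level using (Level; 0ℓ)
open import Data.Nat.Base as ℕ using (zero; suc; z≤n; s≤s)
import Data.Nat.Properties as ℕ
import Data.Integer.Base as ℤ
import Data.Integer.Properties as ℤ
import Data.Nat.Coprimality as Coprimality
open import Data.Rational.Base
  using (ℚ; mkℚ; _/_; _+_; _-_; -_; ∣_∣; _<_; _≤_; _⊓_; ½; 0ℚ; 1ℚ; *≤*)
  renaming (_*_ to _·_)
open import Data.Rational.Properties hiding (_≟_)
import Data.Rational.Properties as ℚ
open import Data.Fin.Base as Fin
  using (Fin; toℕ; opposite; fromℕ<; fromℕ; inject₁; punchOut; combine; remQuot)
  renaming (_<_ to _<ᶠ_)
import Data.Fin.Properties as Fin
open import Data.Fin.Induction using (<-weakInduction; >-weakInduction)
open import Data.Fin.Permutation using (Permutation′; permutation; flip; _∘ₚ_; _⟨$⟩ʳ_; _⟨$⟩ˡ_)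
open import Data.Sum using (inj₁; inj₂)
open import Data.Product using (_,_; proj₁; proj₂; uncurry)
open import Function.Base using (_∘_)
open import Function.Bundles using (_⇔_; mk⇔; Equivalence; Inverse)
import Function.Properties.Equivalence as ⇔
open import Function.Definitions using (Injective; StrictlySurjective)
open import Relation.Binary.Core using (Rel)
open import Relation.Binary.Definitions using (Irreflexive; Asymmetric; tri<; tri≈; tri>)
open import Relation.Binary.PropositionalEquality
  using (_≡_; _≢_; refl; sym; trans; cong; cong₂; subst; subst₂; module ≡-Reasoning)
open import Relation.Nullary using (¬_; yes; no; contradiction)
open import Relation.Nullary.Decidable using (dec⇒maybe)
open import Relation.Unary using (Pred; Decidable; _⊆_)
open import Algebra.Properties.Group +-0-group using (∙-cancelˡ; ⁻¹-involutive)
open import Tactic.RingSolver using (solve-∀)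
import Tactic.RingSolver.Core.AlmostCommutativeRing as ACR

private variable ℓ : Level

ring : ACR.AlmostCommutativeRing 0ℓ 0ℓ
ring = ACR.fromCommutativeRing +-*-commutativeRing (λ q → dec⇒maybe (0ℚ ℚ.≟ q))

p+[q-p]≡q : ∀ p q → p + (q - p) ≡ q
p+[q-p]≡q = solve-∀ ring

p≡[p+p]-p : ∀ p → p ≡ (p + p) - p
p≡[p+p]-p = solve-∀ ring

p·½+p·½≡p : ∀ p → p · ½ + p · ½ ≡ p
p·½+p·½≡p = solve-∀ ring

K-[K-p]≡p : ∀ K p → K - (K - p) ≡ p
K-[K-p]≡p = solve-∀ ring

[p+1]-q≡p+[1-q] : ∀ p q → (p + 1ℚ) - q ≡ p + (1ℚ - q)
[p+1]-q≡p+[1-q] = solve-∀ ring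

p≡0-p⇒p≡0 : ∀ {p} → p ≡ 0ℚ - p → p ≡ 0ℚ
p≡0-p⇒p≡0 {p} p≡-p = begin
  p                      ≡⟨ p≡[p+p]·½ p ⟩
  (p + p) · ½            ≡⟨ cong (λ q → (p + q) · ½) p≡-p ⟩
  (p + (0ℚ - p)) · ½     ≡⟨ [p+[0-p]]·½≡0 p ⟩
  0ℚ                     ∎
  where
  open ≡-Reasoning
  p≡[p+p]·½ : ∀ p → p ≡ (p + p) · ½
  p≡[p+p]·½ = solve-∀ ring
  [p+[0-p]]·½≡0 : ∀ p → (p + (0ℚ - p)) · ½ ≡ 0ℚ
  [p+[0-p]]·½≡0 = solve-∀ ring

p<q⇒0<q-p : ∀ {p q} → p < q → 0ℚ < q - p
p<q⇒0<q-p {p} {q} p<q = subst (_< q - p) (+-inverseʳ p) (+-monoˡ-< (- p) p<q)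

0<p·½ : ∀ {p} → 0ℚ < p → 0ℚ < p · ½
0<p·½ {p} 0<p = subst (_< p · ½) (*-zeroˡ ½) (*-monoˡ-<-pos ½ 0<p)

p·½<p : ∀ {p} → 0ℚ < p → p · ½ < p
p·½<p {p} 0<p = begin-strict
  p · ½            ≡⟨ sym (+-identityʳ (p · ½)) ⟩
  p · ½ + 0ℚ       <⟨ +-monoʳ-< (p · ½) (0<p·½ 0<p) ⟩
  p · ½ + p · ½    ≡⟨ p·½+p·½≡p p ⟩
  p                ∎
  where open ≤-Reasoning

⊓-pos : ∀ {p q} → 0ℚ < p → 0ℚ < q → 0ℚ < p ⊓ q
⊓-pos {p} {q} 0<p 0<q with ⊓-sel p q
... | inj₁ p⊓q≡p = subst (0ℚ <_) (sym p⊓q≡p) 0<p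
... | inj₂ p⊓q≡q = subst (0ℚ <_) (sym p⊓q≡q) 0<q

complement-bounds : ∀ {t} → 0ℚ ≤ t → t ≤ 1ℚ → 0ℚ ≤ 1ℚ - t × 1ℚ - t ≤ 1ℚ
complement-bounds {t} 0≤t t≤1 =
  subst (_≤ 1ℚ - t) (+-inverseʳ t) (+-monoˡ-≤ (- t) t≤1) ,
  subst (1ℚ - t ≤_) (+-identityʳ 1ℚ) (+-monoʳ-≤ 1ℚ (neg-antimono-≤ 0≤t))

reflect-<-⇔ : ∀ K {u v} → (K - u < K - v) ⇔ (v < u)
reflect-<-⇔ K {u} {v} = mk⇔
  (λ lt → subst₂ _<_ (K-[K-p]≡p K v) (K-[K-p]≡p K u) (+-monoʳ-< K (neg-antimono-< lt)))
  (λ v<u → +-monoʳ-< K (neg-antimono-< v<u))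

reflect-injective : ∀ K {u v} → K - u ≡ K - v → u ≡ v
reflect-injective K eq = neg-injective (∙-cancelˡ K _ _ eq)

Within : ℚ → ℚ → Set
Within ε p = - ε < p × p < ε

within-neg : ∀ {ε p} → Within ε p → Within ε (- p)
within-neg {ε} (-ε<p , p<ε) = neg-antimono-< p<ε , subst (- _ <_) (⁻¹-involutive ε) (neg-antimono-< -ε<p)

within-pos : ∀ {ε p} → 0ℚ < p → p < ε → Within ε p
within-pos 0<p p<ε = <-trans (neg-antimono-< (<-trans 0<p p<ε)) 0<p , p<ε

ℕtoℚ≡mkℚ : ∀ m → ℕtoℚ m ≡ mkℚ (ℤ.+ m) 0 (Coprimality.sym (Coprimality.1-coprimeTo m))
ℕtoℚ≡mkℚ m = ↥p/↧p≡p _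

ℕtoℚ-+ : ∀ m n → ℕtoℚ (m ℕ.+ n) ≡ ℕtoℚ m + ℕtoℚ n
ℕtoℚ-+ m n rewrite ℕtoℚ≡mkℚ m | ℕtoℚ≡mkℚ n =
  cong (_/ 1) (trans (ℤ.pos-+ m n) (sym (cong₂ ℤ._+_ (ℤ.*-identityʳ (ℤ.+ m)) (ℤ.*-identityʳ (ℤ.+ n)))))

ℕtoℚ-mono-≤ : ∀ {m n} → m ℕ.≤ n → ℕtoℚ m ≤ ℕtoℚ n
ℕtoℚ-mono-≤ {m} {n} m≤n rewrite ℕtoℚ≡mkℚ m | ℕtoℚ≡mkℚ n =
  *≤* (subst₂ ℤ._≤_ (sym (ℤ.*-identityʳ (ℤ.+ m))) (sym (ℤ.*-identityʳ (ℤ.+ n))) (ℤ.+≤+ m≤n))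

ℕtoℚ-opposite : ∀ {n} (j : Fin n) → ℕtoℚ (toℕ (opposite j)) + (ℕtoℚ (toℕ j) + 1ℚ) ≡ ℕtoℚ n
ℕtoℚ-opposite {n} j = begin
  ℕtoℚ (toℕ (opposite j)) + (ℕtoℚ (toℕ j) + 1ℚ)  ≡⟨ cong (ℕtoℚ (toℕ (opposite j)) +_) (sym (ℕtoℚ-+ (toℕ j) 1)) ⟩
  ℕtoℚ (toℕ (opposite j)) + ℕtoℚ (toℕ j ℕ.+ 1)   ≡⟨ sym (ℕtoℚ-+ (toℕ (opposite j)) (toℕ j ℕ.+ 1)) ⟩
  ℕtoℚ (toℕ (opposite j) ℕ.+ (toℕ j ℕ.+ 1))      ≡⟨ cong ℕtoℚ toℕ-sum ⟩
  ℕtoℚ n                                          ∎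
  where
  open ≡-Reasoning
  toℕ-sum : toℕ (opposite j) ℕ.+ (toℕ j ℕ.+ 1) ≡ n
  toℕ-sum rewrite Fin.opposite-prop j | ℕ.+-comm (toℕ j) 1 = ℕ.m∸n+n≡m (Fin.toℕ<n j)

opposite-< : ∀ {n} {a b : Fin n} → a <ᶠ b → opposite b <ᶠ opposite a
opposite-< {n} {a} {b} a<b rewrite Fin.opposite-prop a | Fin.opposite-prop b =
  ℕ.∸-monoʳ-< (s≤s a<b) (Fin.toℕ<n b)

opposite-<-⇔ : ∀ {n} {a b : Fin n} → (opposite b <ᶠ opposite a) ⇔ (a <ᶠ b)
opposite-<-⇔ {a = a} {b} = mk⇔
  (λ lt → subst₂ _<ᶠ_ (Fin.opposite-involutive a) (Fin.opposite-involutive b) (opposite-< lt))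
  opposite-<

opposite-injective : ∀ {n} → Injective _≡_ _≡_ (opposite {n})
opposite-injective {x = a} {b} eq =
  trans (sym (Fin.opposite-involutive a)) (trans (cong opposite eq) (Fin.opposite-involutive b))

strictlyIncreasing⇒≗id : ∀ {N} (g : Fin N → Fin N) → (∀ {a b} → a <ᶠ b → g a <ᶠ g b) → ∀ k → g k ≡ k
strictlyIncreasing⇒≗id {suc n} g g-mono k = Fin.toℕ-injective (ℕ.≤-antisym (below k) (above k))
  where
  inject₁<suc : ∀ (i : Fin n) → inject₁ i <ᶠ Fin.suc i
  inject₁<suc i = s≤s (ℕ.≤-reflexive (Fin.toℕ-inject₁ i))

  above : ∀ k → toℕ k ℕ.≤ toℕ (g k)
  above = <-weakInduction _ z≤n λ i ih →
    subst (ℕ._≤ toℕ (g (Fin.suc i))) (cong suc (Fin.toℕ-inject₁ i))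
      (ℕ.≤-trans (s≤s ih) (g-mono (inject₁<suc i)))

  below : ∀ k → toℕ (g k) ℕ.≤ toℕ k
  below = >-weakInduction _
    (subst (toℕ (g (fromℕ n)) ℕ.≤_) (sym (Fin.toℕ-fromℕ n)) (Fin.toℕ≤pred[n] (g (fromℕ n))))
    λ i ih → subst (toℕ (g (inject₁ i)) ℕ.≤_) (sym (Fin.toℕ-inject₁ i))
      (ℕ.≤-pred (ℕ.≤-trans (g-mono (inject₁<suc i)) ih))

injective⇒strictlySurjective : ∀ {N} {f : Fin N → Fin N} → Injective _≡_ _≡_ f → StrictlySurjective _≡_ f
injective⇒strictlySurjective {suc n} {f} f-inj k with Fin.any? (λ a → f a Fin.≟ k)
... | yes hit = hit
... | no miss = contradiction (Fin.injective⇒≤ punchOut-injective) ℕ.1+n≰n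
  where
  k≢f : ∀ a → k ≢ f a
  k≢f a k≡fa = miss (a , sym k≡fa)
  punchOut-injective : Injective _≡_ _≡_ (λ a → punchOut (k≢f a))
  punchOut-injective eq = f-inj (Fin.punchOut-injective (k≢f _) (k≢f _) eq)

injective⇒permutation : ∀ {N} (f : Fin N → Fin N) → Injective _≡_ _≡_ f → Permutation′ N
injective⇒permutation f f-inj =
  permutation f (proj₁ ∘ surj) (proj₂ ∘ surj) (λ a → f-inj (proj₂ (surj (f a))))
  where surj = injective⇒strictlySurjective f-inj

remQuot-injective : ∀ {m} n → Injective _≡_ _≡_ (remQuot {m} n)
remQuot-injective {m} n {k} {l} eq =
  trans (sym (Fin.combine-remQuot {m} n k)) (trans (cong (uncurry combine) eq) (Fin.combine-remQuot {m} n l))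

count : ∀ {N} {P : Pred (Fin N) ℓ} → Decidable P → ℕ
count {N = zero}  P? = 0
count {N = suc N} P? with P? Fin.zero
... | yes _ = suc (count (P? ∘ Fin.suc))
... | no  _ = count (P? ∘ Fin.suc)

count≤ : ∀ {N} {P : Pred (Fin N) ℓ} (P? : Decidable P) → count P? ℕ.≤ N
count≤ {N = zero}  P? = z≤n
count≤ {N = suc N} P? with P? Fin.zero
... | yes _ = s≤s (count≤ (P? ∘ Fin.suc))
... | no  _ = ℕ.m≤n⇒m≤1+n (count≤ (P? ∘ Fin.suc))

count< : ∀ {N} {P : Pred (Fin N) ℓ} (P? : Decidable P) {a} → ¬ P a → count P? ℕ.< N
count< {N = suc N} P? {a} ¬Pa with P? Fin.zero | a
... | yes P0 | Fin.zero  = contradiction P0 ¬Pa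
... | yes _  | Fin.suc a = s≤s (count< (P? ∘ Fin.suc) ¬Pa)
... | no  _  | _         = s≤s (count≤ (P? ∘ Fin.suc))

count-mono-≤ : ∀ {N} {P Q : Pred (Fin N) ℓ} (P? : Decidable P) (Q? : Decidable Q) →
               P ⊆ Q → count P? ℕ.≤ count Q?
count-mono-≤ {N = zero}  P? Q? P⊆Q = z≤n
count-mono-≤ {N = suc N} P? Q? P⊆Q with P? Fin.zero | Q? Fin.zero
... | yes P0 | no ¬Q0 = contradiction (P⊆Q P0) ¬Q0
... | yes _  | yes _  = s≤s (count-mono-≤ (P? ∘ Fin.suc) (Q? ∘ Fin.suc) P⊆Q)
... | no _   | yes _  = ℕ.m≤n⇒m≤1+n (count-mono-≤ (P? ∘ Fin.suc) (Q? ∘ Fin.suc) P⊆Q)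
... | no _   | no _   = count-mono-≤ (P? ∘ Fin.suc) (Q? ∘ Fin.suc) P⊆Q

count-mono-< : ∀ {N} {P Q : Pred (Fin N) ℓ} (P? : Decidable P) (Q? : Decidable Q) →
               P ⊆ Q → ∀ {a} → ¬ P a → Q a → count P? ℕ.< count Q?
count-mono-< {N = suc N} P? Q? P⊆Q {a} ¬Pa Qa with P? Fin.zero | Q? Fin.zero | a
... | yes P0 | no ¬Q0 | _         = contradiction (P⊆Q P0) ¬Q0
... | _      | no ¬Q0 | Fin.zero  = contradiction Qa ¬Q0
... | yes P0 | yes _  | Fin.zero  = contradiction P0 ¬Pa
... | no _   | yes _  | Fin.zero  = s≤s (count-mono-≤ (P? ∘ Fin.suc) (Q? ∘ Fin.suc) P⊆Q)
... | yes _  | yes _  | Fin.suc a = s≤s (count-mono-< (P? ∘ Fin.suc) (Q? ∘ Fin.suc) P⊆Q ¬Pa Qa)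
... | no _   | yes _  | Fin.suc a = ℕ.m≤n⇒m≤1+n (count-mono-< (P? ∘ Fin.suc) (Q? ∘ Fin.suc) P⊆Q ¬Pa Qa)
... | no _   | no _   | Fin.suc a = count-mono-< (P? ∘ Fin.suc) (Q? ∘ Fin.suc) P⊆Q ¬Pa Qa

-- Ranking finite families of rationals

strictMono⇒reflects : ∀ {I B : Set} {_≺_ : Rel B 0ℓ} → Irreflexive _≡_ _≺_ → Asymmetric _≺_ →
                      (u : I → ℚ) (v : I → B) → (∀ i j → i ≢ j → u i ≢ u j) →
                      (∀ {i j} → u i < u j → v i ≺ v j) → ∀ {i j} → v i ≺ v j → u i < u j
strictMono⇒reflects ≺-irrefl ≺-asym u v u-distinct v-mono {i} {j} vi≺vj with <-cmp (u i) (u j)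
... | tri< ui<uj _ _ = ui<uj
... | tri> _ _ uj<ui = contradiction (v-mono uj<ui) (≺-asym vi≺vj)
... | tri≈ _ ui≡uj _ = contradiction ui≡uj (u-distinct i j λ { refl → ≺-irrefl refl vi≺vj })

rank : ∀ {N} → (Fin N → ℚ) → Fin N → Fin N
rank v a = fromℕ< (count< (λ b → v b <? v a) (<-irrefl refl))

rank-mono : ∀ {N} (v : Fin N → ℚ) {a b} → v a < v b → rank v a <ᶠ rank v b
rank-mono v {a} {b} va<vb = subst₂ ℕ._<_ (sym (Fin.toℕ-fromℕ< _)) (sym (Fin.toℕ-fromℕ< _))
  (count-mono-< (λ c → v c <? v a) (λ c → v c <? v b) (λ vc<va → <-trans vc<va va<vb) (<-irrefl refl) va<vb)

module Rank {N} (v : Fin N → ℚ) (v-inj : Injective _≡_ _≡_ v) where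

  rank-injective : Injective _≡_ _≡_ (rank v)
  rank-injective {a} {b} eq with <-cmp (v a) (v b)
  ... | tri< va<vb _ _ = contradiction eq (Fin.<⇒≢ (rank-mono v va<vb))
  ... | tri≈ _ va≡vb _ = v-inj va≡vb
  ... | tri> _ _ vb<va = contradiction (sym eq) (Fin.<⇒≢ (rank-mono v vb<va))

  rank-reflects : ∀ {a b} → rank v a <ᶠ rank v b → v a < v b
  rank-reflects = strictMono⇒reflects Fin.<-irrefl Fin.<-asym v (rank v)
    (λ _ _ a≢b va≡vb → a≢b (v-inj va≡vb)) (rank-mono v)

  rankPermutation : Permutation′ N
  rankPermutation = injective⇒permutation (rank v) rank-injective

  unrank : Fin N → Fin N
  unrank = rankPermutation ⟨$⟩ˡ_

  rank-unrank : ∀ k → rank v (unrank k) ≡ k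
  rank-unrank = Inverse.strictlyInverseˡ rankPermutation

  unrank-rank : ∀ a → unrank (rank v a) ≡ a
  unrank-rank = Inverse.strictlyInverseʳ rankPermutation

  unrank-injective : Injective _≡_ _≡_ unrank
  unrank-injective {k} {l} eq = trans (sym (rank-unrank k)) (trans (cong (rank v) eq) (rank-unrank l))

  rank-unique : ∀ (ρ : Fin N → Fin N) → (∀ {a b} → v a < v b → ρ a <ᶠ ρ b) → ∀ a → ρ a ≡ rank v a
  rank-unique ρ ρ-mono a = trans (cong ρ (sym (unrank-rank a)))
    (strictlyIncreasing⇒≗id (ρ ∘ unrank) (λ {k} {l} k<l → ρ-mono (rank-reflects
      (subst₂ _<ᶠ_ (sym (rank-unrank k)) (sym (rank-unrank l)) k<l))) (rank v a))

  rank-reflection : ∀ (R : Fin N → Fin N) K → (∀ a → v (R a) ≡ K - v a) →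
                    ∀ a → rank v (R a) ≡ opposite (rank v a)
  rank-reflection R K v∘R a = trans (sym (Fin.opposite-involutive _))
    (cong opposite (rank-unique (opposite ∘ rank v ∘ R) reflected-mono a))
    where
    reflected-mono : ∀ {a b} → v a < v b → opposite (rank v (R a)) <ᶠ opposite (rank v (R b))
    reflected-mono {a} {b} va<vb = opposite-< (rank-mono v
      (subst₂ _<_ (sym (v∘R b)) (sym (v∘R a)) (Equivalence.from (reflect-<-⇔ K) va<vb)))

module PointSet {N} (X Y : Fin N → ℚ) (X-inj : Injective _≡_ _≡_ X) (Y-inj : Injective _≡_ _≡_ Y) where
  private
    module RX = Rank X X-inj
    module RY = Rank Y Y-inj

  perm : Perm N
  perm = flip RX.rankPermutation ∘ₚ RY.rankPermutation

  private
    perm-rank : ∀ a → perm ⟨$⟩ʳ rank X a ≡ rank Y a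
    perm-rank a = cong (rank Y) (RX.unrank-rank a)

  perm-inGeom : ∀ {r c} {A : Matrix r c} → (∀ k → OnFigure A (X k) (Y k)) → InGeom A perm
  perm-inGeom on =
    X ∘ RX.unrank , Y ∘ RX.unrank , on ∘ RX.unrank ,
    (λ k l k≢l eq → k≢l (RX.unrank-injective (X-inj eq))) ,
    (λ k l k≢l eq → k≢l (RX.unrank-injective (Y-inj eq))) ,
    (λ k l → mk⇔
      (λ k<l → RX.rank-reflects (subst₂ _<ᶠ_ (sym (RX.rank-unrank k)) (sym (RX.rank-unrank l)) k<l))
      (λ lt → subst₂ _<ᶠ_ (RX.rank-unrank k) (RX.rank-unrank l) (rank-mono X lt))) ,
    (λ k l → mk⇔ RY.rank-reflects (rank-mono Y))

  perm-centrosymmetric : ∀ (R : Fin N → Fin N) Kx Ky →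
                         (∀ a → X (R a) ≡ Kx - X a) → (∀ a → Y (R a) ≡ Ky - Y a) → Centrosymmetric perm
  perm-centrosymmetric R Kx Ky X∘R Y∘R k = begin
    opposite (perm ⟨$⟩ʳ opposite k)           ≡⟨ cong (λ l → opposite (perm ⟨$⟩ʳ opposite l)) (sym (RX.rank-unrank k)) ⟩
    opposite (perm ⟨$⟩ʳ opposite (rank X a))  ≡⟨ cong (λ l → opposite (perm ⟨$⟩ʳ l)) (sym (RX.rank-reflection R Kx X∘R a)) ⟩
    opposite (perm ⟨$⟩ʳ rank X (R a))         ≡⟨ cong opposite (perm-rank (R a)) ⟩
    opposite (rank Y (R a))                   ≡⟨ cong opposite (RY.rank-reflection R Ky Y∘R a) ⟩
    opposite (opposite (rank Y a))            ≡⟨ Fin.opposite-involutive _ ⟩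
    rank Y a                                  ∎
    where
    open ≡-Reasoning
    a = RX.unrank k

  perm-contains : ∀ {n} (π : Perm n) (f : Fin n → Fin N) →
                  (∀ {a b} → a <ᶠ b → X (f a) < X (f b)) →
                  (∀ a b → (π ⟨$⟩ʳ a <ᶠ π ⟨$⟩ʳ b) ⇔ (Y (f a) < Y (f b))) →
                  Contains perm π
  perm-contains π f X∘f-mono π≅Y∘f =
    rank X ∘ f , (λ a b a<b → rank-mono X (X∘f-mono a<b)) ,
    λ a b → mk⇔
      (λ πa<πb → subst₂ _<ᶠ_ (sym (perm-rank (f a))) (sym (perm-rank (f b)))
        (rank-mono Y (Equivalence.to (π≅Y∘f a b) πa<πb)))
      (λ lt → Equivalence.from (π≅Y∘f a b)
        (RY.rank-reflects (subst₂ _<ᶠ_ (perm-rank (f a)) (perm-rank (f b)) lt)))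

-- Perturbing a finite configuration

Separated : ∀ {I : Set} → ℚ → (I → ℚ) → Set
Separated g V = ∀ {k l} → V k < V l → V k + g ≤ V l

separated-mono : ∀ {I : Set} {g g'} (V : I → ℚ) → g' ≤ g → Separated g V → Separated g' V
separated-mono V g'≤g sep Vk<Vl = ≤-trans (+-monoʳ-≤ (V _) g'≤g) (sep Vk<Vl)

∃-positiveLowerBound : ∀ {m} (f : Fin m → ℚ) {b} → 0ℚ < b →
                       ∃[ g ] 0ℚ < g × g ≤ b × (∀ k → 0ℚ < f k → g ≤ f k)
∃-positiveLowerBound {zero} f {b} 0<b = b , 0<b , ≤-refl , λ ()
∃-positiveLowerBound {suc m} f {b} 0<b with 0ℚ <? f Fin.zero
... | no f₀≯0 =
  let g , 0<g , g≤b , g≤f = ∃-positiveLowerBound (f ∘ Fin.suc) 0<b in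
  g , 0<g , g≤b , λ { Fin.zero 0<f₀ → contradiction 0<f₀ f₀≯0 ; (Fin.suc k) → g≤f k }
... | yes 0<f₀ =
  let g , 0<g , g≤b⊓f₀ , g≤f = ∃-positiveLowerBound (f ∘ Fin.suc) (⊓-pos 0<b 0<f₀) in
  g , 0<g , ≤-trans g≤b⊓f₀ (p⊓q≤p b _) ,
  λ { Fin.zero _ → ≤-trans g≤b⊓f₀ (p⊓q≤q b _) ; (Fin.suc k) → g≤f k }

∃-gap : ∀ {N} (V : Fin N → ℚ) {b} → 0ℚ < b → ∃[ g ] 0ℚ < g × g ≤ b × Separated g V
∃-gap {N} V 0<b =
  let g , 0<g , g≤b , g≤increment = ∃-positiveLowerBound (increment ∘ remQuot N) 0<b
  in g , 0<g , g≤b , λ {k} {l} Vk<Vl → begin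
    V k + g            ≤⟨ +-monoʳ-≤ (V k) (subst (λ p → 0ℚ < increment p → g ≤ increment p)
                            (Fin.remQuot-combine k l) (g≤increment (combine k l)) (p<q⇒0<q-p Vk<Vl)) ⟩
    V k + (V l - V k)  ≡⟨ p+[q-p]≡q (V k) (V l) ⟩
    V l                ∎
  where
  open ≤-Reasoning
  increment : Fin N × Fin N → ℚ
  increment (k , l) = V l - V k

∃-commonGap : ∀ {N} (V U : Fin N → ℚ) →
              ∃[ ε ] 0ℚ < ε × ε ≤ ½ · ½ × Separated (ε + ε) V × Separated (ε + ε) U
∃-commonGap V U =
  let gV , 0<gV , gV≤½ , sepV = ∃-gap V (positive⁻¹ ½)
      g  , 0<g  , g≤gV , sepU = ∃-gap U 0<gV
  in g · ½ , 0<p·½ 0<g , *-monoʳ-≤-nonNeg ½ (≤-trans g≤gV gV≤½) ,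
     separated-mono V (≤-trans (≤-reflexive (p·½+p·½≡p g)) g≤gV) sepV ,
     separated-mono U (≤-reflexive (p·½+p·½≡p g)) sepU

module Perturbation {I : Set} (V e : I → ℚ) {ε} (gap : Separated (ε + ε) V) (small : ∀ k → Within ε (e k)) where

  perturb-mono : ∀ {k l} → V k < V l → V k + e k < V l + e l
  perturb-mono {k} {l} Vk<Vl = begin-strict
    V k + e k                <⟨ +-monoʳ-< (V k) eₖ<2ε+eₗ ⟩
    V k + ((ε + ε) + e l)    ≡⟨ sym (+-assoc (V k) (ε + ε) (e l)) ⟩
    (V k + (ε + ε)) + e l    ≤⟨ +-monoˡ-≤ (e l) (gap Vk<Vl) ⟩
    V l + e l                ∎
    where
    open ≤-Reasoning
    eₖ<2ε+eₗ : e k < (ε + ε) + e l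
    eₖ<2ε+eₗ = begin-strict
      e k             <⟨ proj₂ (small k) ⟩
      ε               ≡⟨ p≡[p+p]-p ε ⟩
      (ε + ε) - ε     <⟨ +-monoʳ-< (ε + ε) (proj₁ (small l)) ⟩
      (ε + ε) + e l   ∎

  perturb-injective : Injective _≡_ _≡_ e → Injective _≡_ _≡_ (λ k → V k + e k)
  perturb-injective e-inj {k} {l} eq with <-cmp (V k) (V l)
  ... | tri< Vk<Vl _ _ = contradiction eq (<⇒≢ (perturb-mono Vk<Vl))
  ... | tri≈ _ Vk≡Vl _ = e-inj (∙-cancelˡ (V k) (e k) (e l) (trans eq (cong (_+ e l) (sym Vk≡Vl))))
  ... | tri> _ _ Vl<Vk = contradiction (sym eq) (<⇒≢ (perturb-mono Vl<Vk))

halves : ℚ → ℕ → ℚ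
halves q zero    = q · ½
halves q (suc k) = halves q k · ½

module _ {q} (0<q : 0ℚ < q) where

  halves-pos : ∀ k → 0ℚ < halves q k
  halves-pos zero    = 0<p·½ 0<q
  halves-pos (suc k) = 0<p·½ (halves-pos k)

  halves-< : ∀ k → halves q k < q
  halves-< zero    = p·½<p 0<q
  halves-< (suc k) = <-trans (p·½<p (halves-pos k)) (halves-< k)

  halves-antitone : ∀ {k l} → k ℕ.< l → halves q l < halves q k
  halves-antitone {k} {suc l} (s≤s k≤l) with ℕ.m≤n⇒m<n∨m≡n k≤l
  ... | inj₁ k<l  = <-trans (p·½<p (halves-pos l)) (halves-antitone k<l)
  ... | inj₂ refl = p·½<p (halves-pos k)

  halves-injective : Injective _≡_ _≡_ (halves q)
  halves-injective {k} {l} eq with ℕ.<-cmp k l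
  ... | tri< k<l _ _ = contradiction (sym eq) (<⇒≢ (halves-antitone k<l))
  ... | tri≈ _ k≡l _ = k≡l
  ... | tri> _ _ l<k = contradiction eq (<⇒≢ (halves-antitone l<k))

-- The values of height and orient at e0 are junk: cellY e0 is empty, so no point lies on such a cell.
height : Entry → ℚ → ℚ
height e-1 t = 1ℚ - t
height _   t = t

orient : Entry → ℚ → ℚ
orient e-1 d = - d
orient _   d = d

height-bounds : ∀ e {t} → 0ℚ ≤ t → t ≤ 1ℚ → 0ℚ ≤ height e t × height e t ≤ 1ℚ
height-bounds e0  0≤t t≤1 = 0≤t , t≤1
height-bounds e+1 0≤t t≤1 = 0≤t , t≤1
height-bounds e-1 0≤t t≤1 = complement-bounds 0≤t t≤1

height-shift : ∀ e t d → height e (t + d) ≡ height e t + orient e d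
height-shift e0  t d = refl
height-shift e+1 t d = refl
height-shift e-1 t d = 1-[t+d]≡[1-t]-d t d
  where
  1-[t+d]≡[1-t]-d : ∀ t d → 1ℚ - (t + d) ≡ (1ℚ - t) + - d
  1-[t+d]≡[1-t]-d = solve-∀ ring

∣orient∣ : ∀ e {d} → 0ℚ ≤ d → ∣ orient e d ∣ ≡ d
∣orient∣ e0  0≤d = 0≤p⇒∣p∣≡p 0≤d
∣orient∣ e+1 0≤d = 0≤p⇒∣p∣≡p 0≤d
∣orient∣ e-1 {d} 0≤d = trans (∣-p∣≡∣p∣ d) (0≤p⇒∣p∣≡p 0≤d)

within-orient : ∀ e {ε d} → 0ℚ < d → d < ε → Within ε (orient e d)
within-orient e0  0<d d<ε = within-pos 0<d d<ε
within-orient e+1 0<d d<ε = within-pos 0<d d<ε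
within-orient e-1 0<d d<ε = within-neg (within-pos 0<d d<ε)

base : ∀ {n} → Fin n → ℚ
base j = ℕtoℚ (toℕ j)

reflect-coordinate : ∀ {n} (j : Fin n) s → ℕtoℚ n - (base j + s) ≡ base (opposite j) + (1ℚ - s)
reflect-coordinate {n} j s = begin
  ℕtoℚ n - (base j + s)                               ≡⟨ cong (_- (base j + s)) (sym (ℕtoℚ-opposite j)) ⟩
  (base (opposite j) + (base j + 1ℚ)) - (base j + s)  ≡⟨ [a+[b+1]]-[b+s]≡a+[1-s] (base (opposite j)) (base j) s ⟩
  base (opposite j) + (1ℚ - s)                        ∎
  where
  open ≡-Reasoning
  [a+[b+1]]-[b+s]≡a+[1-s] : ∀ a b s → (a + (b + 1ℚ)) - (b + s) ≡ a + (1ℚ - s)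
  [a+[b+1]]-[b+s]≡a+[1-s] = solve-∀ ring

cellY-height : ∀ e {r} (i : Fin r) {t y} → cellY e i t y → y ≡ base (opposite i) + height e t
cellY-height e+1 i refl = refl
cellY-height e-1 i {t} refl = [p+1]-q≡p+[1-q] (base (opposite i)) t

cellY-move : ∀ {e r r'} {i : Fin r} {t y} → cellY e i t y → ∀ (i' : Fin r') u →
             cellY e i' u (base (opposite i') + height e u)
cellY-move {e+1} _ i' u = refl
cellY-move {e-1} _ i' u = sym ([p+1]-q≡p+[1-q] (base (opposite i')) u)

module _ {r c} {A : Matrix r c} {x y : ℚ} where

  row : OnFigure A x y → Fin r
  row (i , _) = i

  column : OnFigure A x y → Fin c
  column (_ , j , _) = j

  entry : OnFigure A x y → Entry
  entry P = A (row P) (column P)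

  param : OnFigure A x y → ℚ
  param (_ , _ , t , _) = t

  param-bounds : (P : OnFigure A x y) → 0ℚ ≤ param P × param P ≤ 1ℚ
  param-bounds (_ , _ , _ , 0≤t , t≤1 , _) = 0≤t , t≤1

  x-param : (P : OnFigure A x y) → x ≡ base (column P) + param P
  x-param (_ , _ , _ , _ , _ , x≡ , _) = x≡

  y-param : (P : OnFigure A x y) → y ≡ base (opposite (row P)) + height (entry P) (param P)
  y-param (i , j , _ , _ , _ , _ , on) = cellY-height (A i j) i on

  slide : (P : OnFigure A x y) → ∀ {u} → 0ℚ ≤ u → u ≤ 1ℚ →
          OnFigure A (base (column P) + u) (base (opposite (row P)) + height (entry P) u)
  slide (i , j , _ , _ , _ , _ , on) {u} 0≤u u≤1 = i , j , u , 0≤u , u≤1 , refl , cellY-move on i u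

  reflect-onFigure : CentrosymmetricMatrix A → OnFigure A x y → OnFigure A (ℕtoℚ c - x) (ℕtoℚ r - y)
  reflect-onFigure cs P@(i , j , t , 0≤t , t≤1 , refl , on) =
    opposite i , opposite j , 1ℚ - t ,
    proj₁ (complement-bounds 0≤t t≤1) , proj₂ (complement-bounds 0≤t t≤1) , reflect-coordinate j t ,
    subst (λ e → cellY e (opposite i) (1ℚ - t) (ℕtoℚ r - y)) (cs i j)
      (subst (cellY (A i j) (opposite i) (1ℚ - t)) (sym y-reflected) (cellY-move on (opposite i) (1ℚ - t)))
    where
    height-complement : ∀ e → height e (1ℚ - t) ≡ 1ℚ - height e t
    height-complement e0  = refl
    height-complement e+1 = refl
    height-complement e-1 = refl
    y-reflected : ℕtoℚ r - y ≡ base (opposite (opposite i)) + height (A i j) (1ℚ - t)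
    y-reflected = begin
      ℕtoℚ r - y                                               ≡⟨ cong (λ y → ℕtoℚ r - y) (y-param P) ⟩
      ℕtoℚ r - (base (opposite i) + height (A i j) t)          ≡⟨ reflect-coordinate (opposite i) _ ⟩
      base (opposite (opposite i)) + (1ℚ - height (A i j) t)   ≡⟨ cong (λ h → base (opposite (opposite i)) + h)
                                                                       (sym (height-complement (A i j))) ⟩
      base (opposite (opposite i)) + height (A i j) (1ℚ - t)   ∎
      where open ≡-Reasoning

rc-involutive : ∀ {n} (π : Perm n) i → rc (rc π) ⟨$⟩ʳ i ≡ π ⟨$⟩ʳ i
rc-involutive π i = trans (Fin.opposite-involutive _) (cong (π ⟨$⟩ʳ_) (Fin.opposite-involutive i))

rc-inGeom : ∀ {r c} {A : Matrix r c} → CentrosymmetricMatrix A → ∀ {n} (π : Perm n) → InGeom A π → InGeom A (rc π)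
rc-inGeom {r} {c} cs π (x , y , on , x-distinct , y-distinct , x≅ , y≅) =
  (λ a → ℕtoℚ c - x (opposite a)) , (λ a → ℕtoℚ r - y (opposite a)) ,
  (λ a → reflect-onFigure cs (on (opposite a))) ,
  (λ a b a≢b eq → x-distinct _ _ (a≢b ∘ opposite-injective) (reflect-injective (ℕtoℚ c) eq)) ,
  (λ a b a≢b eq → y-distinct _ _ (a≢b ∘ opposite-injective) (reflect-injective (ℕtoℚ r) eq)) ,
  (λ a b → ⇔.trans (⇔.sym opposite-<-⇔) (⇔.trans (x≅ (opposite b) (opposite a)) (⇔.sym (reflect-<-⇔ (ℕtoℚ c))))) ,
  (λ a b → ⇔.trans opposite-<-⇔ (⇔.trans (y≅ (opposite b) (opposite a)) (⇔.sym (reflect-<-⇔ (ℕtoℚ r)))))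

rcInvariant : ∀ {r c} {A : Matrix r c} → CentrosymmetricMatrix A → RcInvariant (InGeom A)
rcInvariant cs = rc-inGeom cs , λ π π∈A → rc π , rc-inGeom cs π π∈A , rc-involutive π

-- Shrinking a segment towards its midpoint

shrink : ℚ → ℚ
shrink t = (t + ½) · ½

shrink-mono-≤ : ∀ {t t'} → t ≤ t' → shrink t ≤ shrink t'
shrink-mono-≤ t≤t' = *-monoʳ-≤-nonNeg ½ (+-monoˡ-≤ ½ t≤t')

height-shrink : ∀ e t → height e (shrink t) ≡ shrink (height e t)
height-shrink e0  t = refl
height-shrink e+1 t = refl
height-shrink e-1 t = 1-shrink[t]≡shrink[1-t] t
  where
  1-shrink[t]≡shrink[1-t] : ∀ t → 1ℚ - (t + ½) · ½ ≡ ((1ℚ - t) + ½) · ½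
  1-shrink[t]≡shrink[1-t] = solve-∀ ring

shifted-shrink-bounds : ∀ {t d} → 0ℚ ≤ t → t ≤ 1ℚ → 0ℚ ≤ d → d ≤ ½ · ½ →
                        0ℚ ≤ shrink t + d × shrink t + d ≤ 1ℚ
shifted-shrink-bounds {t} {d} 0≤t t≤1 0≤d d≤¼ = lower , upper
  where
  open ≤-Reasoning
  lower = begin
    0ℚ                ≤⟨ ≤ᵇ⇒≤ _ ⟩
    shrink 0ℚ         ≤⟨ shrink-mono-≤ 0≤t ⟩
    shrink t          ≡⟨ sym (+-identityʳ (shrink t)) ⟩
    shrink t + 0ℚ     ≤⟨ +-monoʳ-≤ (shrink t) 0≤d ⟩
    shrink t + d      ∎
  upper = begin
    shrink t + d          ≤⟨ +-mono-≤ (shrink-mono-≤ t≤1) d≤¼ ⟩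
    shrink 1ℚ + ½ · ½     ≡⟨⟩
    1ℚ                    ∎

cell-index-≤ : ∀ J₁ J₂ {s₁ s₂} → 0ℚ ≤ s₁ → s₂ ≤ 1ℚ → ℕtoℚ J₁ + s₁ < ℕtoℚ J₂ + s₂ → ℕtoℚ J₁ ≤ ℕtoℚ J₂
cell-index-≤ J₁ J₂ {s₁} {s₂} 0≤s₁ s₂≤1 lt with J₁ ℕ.≤? J₂
... | yes J₁≤J₂ = ℕtoℚ-mono-≤ J₁≤J₂
... | no  J₁≰J₂ = contradiction (<-≤-trans lt J₂+s₂≤J₁+s₁) (<-irrefl refl)
  where
  open ≤-Reasoning
  J₂+s₂≤J₁+s₁ : ℕtoℚ J₂ + s₂ ≤ ℕtoℚ J₁ + s₁
  J₂+s₂≤J₁+s₁ = begin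
    ℕtoℚ J₂ + s₂      ≤⟨ +-monoʳ-≤ (ℕtoℚ J₂) s₂≤1 ⟩
    ℕtoℚ J₂ + 1ℚ      ≡⟨ trans (+-comm (ℕtoℚ J₂) 1ℚ) (sym (ℕtoℚ-+ 1 J₂)) ⟩
    ℕtoℚ (suc J₂)     ≤⟨ ℕtoℚ-mono-≤ (ℕ.≰⇒> J₁≰J₂) ⟩
    ℕtoℚ J₁           ≡⟨ sym (+-identityʳ (ℕtoℚ J₁)) ⟩
    ℕtoℚ J₁ + 0ℚ      ≤⟨ +-monoʳ-≤ (ℕtoℚ J₁) 0≤s₁ ⟩
    ℕtoℚ J₁ + s₁      ∎

cell-shrink-< : ∀ J₁ J₂ {s₁ s₂} → 0ℚ ≤ s₁ → s₂ ≤ 1ℚ →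
                ℕtoℚ J₁ + s₁ < ℕtoℚ J₂ + s₂ → ℕtoℚ J₁ + shrink s₁ < ℕtoℚ J₂ + shrink s₂
cell-shrink-< J₁ J₂ {s₁} {s₂} 0≤s₁ s₂≤1 lt =
  subst₂ _<_ (sym (J+shrink[s] (ℕtoℚ J₁) s₁)) (sym (J+shrink[s] (ℕtoℚ J₂) s₂))
    (*-monoˡ-<-pos ½ (+-mono-<-≤ lt (+-monoˡ-≤ ½ (cell-index-≤ J₁ J₂ 0≤s₁ s₂≤1 lt))))
  where
  J+shrink[s] : ∀ J s → J + (s + ½) · ½ ≡ ((J + s) + (J + ½)) · ½
  J+shrink[s] = solve-∀ ring

-- Doubling a configuration by its reflection

mirror : ∀ {n} → ℚ → (Fin n → ℚ) → Fin 2 × Fin n → ℚ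
mirror K v (Fin.zero  , a) = v a
mirror K v (Fin.suc _ , a) = K - v a

mirrorIndex : ∀ {n} → Fin 2 × Fin n → Fin 2 × Fin n
mirrorIndex (Fin.zero  , a) = Fin.suc Fin.zero , a
mirrorIndex (Fin.suc _ , a) = Fin.zero , a

mirror-mirrorIndex : ∀ {n} K (v : Fin n → ℚ) p → mirror K v (mirrorIndex p) ≡ K - mirror K v p
mirror-mirrorIndex K v (Fin.zero  , a) = refl
mirror-mirrorIndex K v (Fin.suc _ , a) = sym (K-[K-p]≡p K (v a))

module _ {n} {w δ : Fin n → ℚ} (∣w∣≡δ : ∀ a → ∣ w a ∣ ≡ δ a) (δ-pos : ∀ a → 0ℚ < δ a) where

  ∣mirror∣≡δ : ∀ p → ∣ mirror 0ℚ w p ∣ ≡ δ (proj₂ p)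
  ∣mirror∣≡δ (Fin.zero  , a) = ∣w∣≡δ a
  ∣mirror∣≡δ (Fin.suc _ , a) = trans (cong ∣_∣ (+-identityˡ (- w a))) (trans (∣-p∣≡∣p∣ (w a)) (∣w∣≡δ a))

  mirror-injective : Injective _≡_ _≡_ δ → Injective _≡_ _≡_ (mirror 0ℚ w)
  mirror-injective δ-inj {b , a} {b' , a'} eq
    with refl ← δ-inj (trans (sym (∣mirror∣≡δ (b , a))) (trans (cong ∣_∣ eq) (∣mirror∣≡δ (b' , a'))))
    = cong (_, a) (sides b b' eq)
    where
    not-self-negating : w a ≢ 0ℚ - w a
    not-self-negating wₐ≡-wₐ = <⇒≢ (δ-pos a) (trans (sym (cong ∣_∣ (p≡0-p⇒p≡0 wₐ≡-wₐ))) (∣w∣≡δ a))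
    sides : ∀ b b' → mirror 0ℚ w (b , a) ≡ mirror 0ℚ w (b' , a) → b ≡ b'
    sides Fin.zero           Fin.zero           _  = refl
    sides (Fin.suc Fin.zero) (Fin.suc Fin.zero) _  = refl
    sides Fin.zero           (Fin.suc Fin.zero) eq = contradiction eq not-self-negating
    sides (Fin.suc Fin.zero) Fin.zero           eq = contradiction (sym eq) not-self-negating

doubled : ∀ {n} → ℚ → (Fin n → ℚ) → Fin (2 * n) → ℚ
doubled {n} K v = mirror K v ∘ remQuot {2} n

reflectIndex : ∀ {n} → Fin (2 * n) → Fin (2 * n)
reflectIndex {n} = uncurry combine ∘ mirrorIndex ∘ remQuot {2} n

embed : ∀ {n} → Fin n → Fin (2 * n)
embed {n} = combine {2} {n} Fin.zero

module _ {n : ℕ} where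

  doubled-reflectIndex : ∀ K (v : Fin n → ℚ) k → doubled K v (reflectIndex {n} k) ≡ K - doubled K v k
  doubled-reflectIndex K v k = trans
    (cong (mirror K v) (uncurry (Fin.remQuot-combine {2} {n}) (mirrorIndex (remQuot {2} n k))))
    (mirror-mirrorIndex K v (remQuot {2} n k))

  doubled-embed : ∀ K (v : Fin n → ℚ) a → doubled K v (embed a) ≡ v a
  doubled-embed K v a = cong (mirror K v) (Fin.remQuot-combine {2} {n} Fin.zero a)

  doubled-+ : ∀ K {v v₀ d : Fin n → ℚ} → (∀ a → v a ≡ v₀ a + d a) →
              ∀ k → doubled K v k ≡ doubled K v₀ k + doubled 0ℚ d k
  doubled-+ K {v₀ = v₀} {d} v≡ k with remQuot {2} n k
  ... | Fin.zero  , a = v≡ a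
  ... | Fin.suc _ , a = trans (cong (λ q → K - q) (v≡ a)) (K-[p+q]≡[K-p]+[0-q] K (v₀ a) (d a))
    where
    K-[p+q]≡[K-p]+[0-q] : ∀ K p q → K - (p + q) ≡ (K - p) + (0ℚ - q)
    K-[p+q]≡[K-p]+[0-q] = solve-∀ ring

  doubled-within : ∀ {ε} {w : Fin n → ℚ} → (∀ a → Within ε (w a)) → ∀ k → Within ε (doubled 0ℚ w k)
  doubled-within {ε} {w} w-within k with remQuot {2} n k
  ... | Fin.zero  , a = w-within a
  ... | Fin.suc _ , a = subst (Within ε) (sym (+-identityˡ (- w a))) (within-neg (w-within a))

  doubled-injective : ∀ {w δ : Fin n → ℚ} → (∀ a → ∣ w a ∣ ≡ δ a) → (∀ a → 0ℚ < δ a) →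
                      Injective _≡_ _≡_ δ → Injective _≡_ _≡_ (doubled 0ℚ w)
  doubled-injective ∣w∣≡δ δ-pos δ-inj eq = remQuot-injective n (mirror-injective ∣w∣≡δ δ-pos δ-inj eq)

module Symmetrisation {r c} {A : Matrix r c} (cs : CentrosymmetricMatrix A) {n} (π : Perm n)
  {x y : Fin n → ℚ} (on : ∀ a → OnFigure A (x a) (y a)) (y-distinct : ∀ a b → a ≢ b → y a ≢ y b)
  (x≅ : ∀ a b → (a <ᶠ b) ⇔ (x a < x b)) (y≅ : ∀ a b → (π ⟨$⟩ʳ a <ᶠ π ⟨$⟩ʳ b) ⇔ (y a < y b)) where

  private
    t : Fin n → ℚ
    t a = param (on a)

    t-bounds : ∀ a → 0ℚ ≤ t a × t a ≤ 1ℚ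
    t-bounds a = param-bounds (on a)

    e : Fin n → Entry
    e a = entry (on a)

    j i : Fin n → ℕ
    j a = toℕ (column (on a))
    i a = toℕ (opposite (row (on a)))

  x₀ y₀ : Fin n → ℚ
  x₀ a = ℕtoℚ (j a) + shrink (t a)
  y₀ a = ℕtoℚ (i a) + shrink (height (e a) (t a))

  x₀-mono : ∀ {a b} → x a < x b → x₀ a < x₀ b
  x₀-mono {a} {b} xa<xb = cell-shrink-< (j a) (j b) (proj₁ (t-bounds a)) (proj₂ (t-bounds b))
    (subst₂ _<_ (x-param (on a)) (x-param (on b)) xa<xb)

  y₀-mono : ∀ {a b} → y a < y b → y₀ a < y₀ b
  y₀-mono {a} {b} ya<yb = cell-shrink-< (i a) (i b)
    (proj₁ (uncurry (height-bounds (e a)) (t-bounds a))) (proj₂ (uncurry (height-bounds (e b)) (t-bounds b)))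
    (subst₂ _<_ (y-param (on a)) (y-param (on b)) ya<yb)

  module _ {ε} (0<ε : 0ℚ < ε) (ε≤¼ : ε ≤ ½ · ½)
           (sepX : Separated (ε + ε) (doubled (ℕtoℚ c) x₀)) (sepY : Separated (ε + ε) (doubled (ℕtoℚ r) y₀)) where

    private
      δ : Fin n → ℚ
      δ a = halves ε (toℕ a)

      δ-pos : ∀ a → 0ℚ < δ a
      δ-pos a = halves-pos 0<ε (toℕ a)

      δ<ε : ∀ a → δ a < ε
      δ<ε a = halves-< 0<ε (toℕ a)

      δ-injective : Injective _≡_ _≡_ δ
      δ-injective eq = Fin.toℕ-injective (halves-injective 0<ε eq)

      w : Fin n → ℚ
      w a = orient (e a) (δ a)

      u : Fin n → ℚ
      u a = shrink (t a) + δ a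

      u-bounds : ∀ a → 0ℚ ≤ u a × u a ≤ 1ℚ
      u-bounds a = shifted-shrink-bounds (proj₁ (t-bounds a)) (proj₂ (t-bounds a))
        (<⇒≤ (δ-pos a)) (≤-trans (<⇒≤ (δ<ε a)) ε≤¼)

      x̃ ỹ : Fin n → ℚ
      x̃ a = ℕtoℚ (j a) + u a
      ỹ a = ℕtoℚ (i a) + height (e a) (u a)

      x̃≡x₀+δ : ∀ a → x̃ a ≡ x₀ a + δ a
      x̃≡x₀+δ a = sym (+-assoc (ℕtoℚ (j a)) (shrink (t a)) (δ a))

      ỹ≡y₀+w : ∀ a → ỹ a ≡ y₀ a + w a
      ỹ≡y₀+w a = begin
        ℕtoℚ (i a) + height (e a) (shrink (t a) + δ a)    ≡⟨ cong (ℕtoℚ (i a) +_) (height-shift (e a) (shrink (t a)) (δ a)) ⟩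
        ℕtoℚ (i a) + (height (e a) (shrink (t a)) + w a)  ≡⟨ cong (λ h → ℕtoℚ (i a) + (h + w a)) (height-shrink (e a) (t a)) ⟩
        ℕtoℚ (i a) + (shrink (height (e a) (t a)) + w a)  ≡⟨ sym (+-assoc (ℕtoℚ (i a)) _ (w a)) ⟩
        y₀ a + w a                                        ∎
        where open ≡-Reasoning

      X Y : Fin (2 * n) → ℚ
      X = doubled (ℕtoℚ c) x̃
      Y = doubled (ℕtoℚ r) ỹ

      onFigure : ∀ k → OnFigure A (X k) (Y k)
      onFigure k with remQuot {2} n k
      ... | Fin.zero  , a = slide (on a) (proj₁ (u-bounds a)) (proj₂ (u-bounds a))
      ... | Fin.suc _ , a = reflect-onFigure cs (slide (on a) (proj₁ (u-bounds a)) (proj₂ (u-bounds a)))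

      module PX = Perturbation (doubled (ℕtoℚ c) x₀) (doubled 0ℚ δ) sepX
                    (doubled-within (λ a → within-pos (δ-pos a) (δ<ε a)))
      module PY = Perturbation (doubled (ℕtoℚ r) y₀) (doubled 0ℚ w) sepY
                    (doubled-within (λ a → within-orient (e a) (δ-pos a) (δ<ε a)))

      X-injective : Injective _≡_ _≡_ X
      X-injective {k} {l} eq = PX.perturb-injective
        (doubled-injective (λ a → 0≤p⇒∣p∣≡p (<⇒≤ (δ-pos a))) δ-pos δ-injective)
        (trans (sym (doubled-+ (ℕtoℚ c) x̃≡x₀+δ k)) (trans eq (doubled-+ (ℕtoℚ c) x̃≡x₀+δ l)))

      Y-injective : Injective _≡_ _≡_ Y
      Y-injective {k} {l} eq = PY.perturb-injective
        (doubled-injective (λ a → ∣orient∣ (e a) (<⇒≤ (δ-pos a))) δ-pos δ-injective)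
        (trans (sym (doubled-+ (ℕtoℚ r) ỹ≡y₀+w k)) (trans eq (doubled-+ (ℕtoℚ r) ỹ≡y₀+w l)))

      X∘embed-mono : ∀ {a b} → x a < x b → X (embed a) < X (embed b)
      X∘embed-mono {a} {b} xa<xb =
        subst₂ _<_ (sym (doubled-+ (ℕtoℚ c) x̃≡x₀+δ (embed a))) (sym (doubled-+ (ℕtoℚ c) x̃≡x₀+δ (embed b)))
          (PX.perturb-mono (subst₂ _<_ (sym (doubled-embed _ x₀ a)) (sym (doubled-embed _ x₀ b)) (x₀-mono xa<xb)))

      Y∘embed-mono : ∀ {a b} → y a < y b → Y (embed a) < Y (embed b)
      Y∘embed-mono {a} {b} ya<yb =
        subst₂ _<_ (sym (doubled-+ (ℕtoℚ r) ỹ≡y₀+w (embed a))) (sym (doubled-+ (ℕtoℚ r) ỹ≡y₀+w (embed b)))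
          (PY.perturb-mono (subst₂ _<_ (sym (doubled-embed _ y₀ a)) (sym (doubled-embed _ y₀ b)) (y₀-mono ya<yb)))

      open PointSet X Y X-injective Y-injective

    perturbedExtension : ∃[ m ] Σ (Perm (2 * m)) λ σ → InGeom A σ × Centrosymmetric σ × Contains σ π
    perturbedExtension = n , perm , perm-inGeom onFigure ,
      perm-centrosymmetric (reflectIndex {n}) (ℕtoℚ c) (ℕtoℚ r)
        (doubled-reflectIndex (ℕtoℚ c) x̃) (doubled-reflectIndex (ℕtoℚ r) ỹ) ,
      perm-contains π embed (X∘embed-mono ∘ Equivalence.to (x≅ _ _))
        (λ a b → mk⇔ (Y∘embed-mono ∘ Equivalence.to (y≅ a b))
          (Equivalence.from (y≅ a b) ∘ strictMono⇒reflects <-irrefl <-asym y (Y ∘ embed) y-distinct Y∘embed-mono))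

  symmetricExtension : ∃[ m ] Σ (Perm (2 * m)) λ σ → InGeom A σ × Centrosymmetric σ × Contains σ π
  symmetricExtension =
    let ε , 0<ε , ε≤¼ , sepX , sepY = ∃-commonGap (doubled (ℕtoℚ c) x₀) (doubled (ℕtoℚ r) y₀)
    in perturbedExtension 0<ε ε≤¼ sepX sepY

proposition3p1 : ∀ {r c} (A : Matrix r c) → CentrosymmetricMatrix A →
    RcInvariant (InGeom A) ×
    (∀ {n} (π : Perm n) → InGeom A π →
       ∃[ m ] Σ (Perm (2 * m)) λ σ →
         InGeom A σ × Centrosymmetric σ × Contains σ π)
proposition3p1 A cs = rcInvariant cs ,
  λ π (_ , _ , on , _ , y-distinct , x≅ , y≅) → Symmetrisation.symmetricExtension cs π on y-distinct x≅ y≅
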